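{- Let $\mathcal{T}$ be a test cover of $[n]$, $k$ a positive integer, and let $\mathcal{F}$ be the output of Greedy-mini-test on $\mathcal{T}$ and $k$, where $|\mathcal{F}|<2k-2$. Let $C_1,\ldots,C_l$ be the classes induced by $\mathcal{F}$. Then no test $S\in\mathcal{T}\setminus\mathcal{F}$ is both a $C_i$-test and a $C_j$-test for $i\neq j$.
   Context: $[n]=\{1,\ldots,n\}$ is the set of items; tests are subsets of $[n]$ and $\mathcal{T}$ is a collection of distinct tests. A test $T$ separates distinct items $i,j$ if $|\{i,j\}\cap T|=1$; a collection of tests is a test cover of $[n]$ if every pair of distinct items is separated by one of its tests. The classes induced by a collection $\mathcal{F}$ of tests are the equivalence classes of the relation "$i,j$ are not separated by any test of $\mathcal{F}$". For $C\subseteq[n]$, a test $S\in\mathcal{T}$ is a $C$-test if $C\setminus S\neq\emptyset$ and $C\cap S\neq\emptyset$. Algorithm Greedy-mini-test($\mathcal{T}$, $k$): start with $\mathcal{F}=\emptyset$; repeatedly, as long as $|\mathcal{F}|<2k-2$ and one of the following moves is possible, perform one: (a) add two tests of $\mathcal{T}\setminus\mathcal{F}$ to $\mathcal{F}$ if this increases the number of classes induced by $\mathcal{F}$ by at least $3$; (b) add one test of $\mathcal{T}\setminus\mathcal{F}$ if this increases the number of classes induced by $\mathcal{F}$ by at least $2$. Stop when $|\mathcal{F}|\ge 2k-2$ or no move is possible, and output $\mathcal{F}$. -}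

module Defs where

open import Data.Nat using (ℕ; _+_; _*_; _∸_; _≤_; _<ᵇ_)
open import Data.Bool using (Bool; true; false; _∧_; _xor_; not; T)
open import Data.Fin using (Fin; toℕ)
open import Data.Fin.Subset using (Subset; _∈_; _∉_; ⁅_⁆; _∪_; ∣_∣; ⊥)
open import Data.Vec using (lookup)
open import Data.List using (List; allFin; filter; length)
open import Data.Bool.ListAction using (any)
open import Data.Product using (Σ; ∃; _×_; _,_)
open import Data.Sum using (_⊎_)
open import Relation.Nullary using (¬_)
open import Relation.Binary.PropositionalEquality using (_≡_; _≢_)
open import Function using (_⇔_; Injective)

-- Items are Fin n. A test is a Subset n.
-- The collection 𝒯 of distinct tests is an injective family  𝒯 : Fin m → Subset n.
-- A subcollection ℱ ⊆ 𝒯 is a Subset m (the indices of the chosen tests).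

Separates : ∀ {n} → Subset n → Fin n → Fin n → Set
Separates S i j = (i ∈ S × j ∉ S) ⊎ (i ∉ S × j ∈ S)

Distinct : ∀ {n m} → (Fin m → Subset n) → Set
Distinct 𝒯 = Injective _≡_ _≡_ 𝒯

IsTestCover : ∀ {n m} → (Fin m → Subset n) → Set
IsTestCover {n} {m} 𝒯 = (i j : Fin n) → i ≢ j → ∃ λ t → Separates (𝒯 t) i j

Unseparated : ∀ {n m} → (Fin m → Subset n) → Subset m → Fin n → Fin n → Set
Unseparated 𝒯 ℱ i j = ∀ t → t ∈ ℱ → ¬ Separates (𝒯 t) i j

IsClass : ∀ {n m} → (Fin m → Subset n) → Subset m → Subset n → Set
IsClass {n} 𝒯 ℱ C = ∃ λ i → (j : Fin n) → (j ∈ C ⇔ Unseparated 𝒯 ℱ i j)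

IsCTest : ∀ {n} → Subset n → Subset n → Set
IsCTest C S = (∃ λ x → x ∈ C × x ∉ S) × (∃ λ y → y ∈ C × y ∈ S)

unsepᵇ : ∀ {n m} → (Fin m → Subset n) → Subset m → Fin n → Fin n → Bool
unsepᵇ {n} {m} 𝒯 ℱ i j =
  not (any (λ t → lookup ℱ t ∧ (lookup (𝒯 t) i xor lookup (𝒯 t) j)) (allFin m))

-- the number of classes induced by ℱ = number of items that are the
-- smallest element of their class
numClasses : ∀ {n m} → (Fin m → Subset n) → Subset m → ℕ
numClasses {n} 𝒯 ℱ = length (filter (λ i → T? (isRep i)) (allFin n))
  where
  isRep : Fin n → Bool
  isRep i = not (any (λ j → (toℕ j <ᵇ toℕ i) ∧ unsepᵇ 𝒯 ℱ j i) (allFin n))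
  open import Relation.Nullary.Decidable using () renaming (T? to T?)

-- one move of Greedy-mini-test (ignoring the size guard)
data Move {n m} (𝒯 : Fin m → Subset n) (ℱ : Subset m) : Subset m → Set where
  moveA : (s t : Fin m) → s ≢ t → s ∉ ℱ → t ∉ ℱ →
          numClasses 𝒯 ℱ + 3 ≤ numClasses 𝒯 (ℱ ∪ (⁅ s ⁆ ∪ ⁅ t ⁆)) →
          Move 𝒯 ℱ (ℱ ∪ (⁅ s ⁆ ∪ ⁅ t ⁆))
  moveB : (t : Fin m) → t ∉ ℱ →
          numClasses 𝒯 ℱ + 2 ≤ numClasses 𝒯 (ℱ ∪ ⁅ t ⁆) →
          Move 𝒯 ℱ (ℱ ∪ ⁅ t ⁆)

data Reachable {n m} (𝒯 : Fin m → Subset n) (k : ℕ) : Subset m → Set where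
  start : Reachable 𝒯 k ⊥
  step  : ∀ {ℱ ℱ'} → Reachable 𝒯 k ℱ → ∣ ℱ ∣ Data.Nat.< 2 * k ∸ 2 →
          Move 𝒯 ℱ ℱ' → Reachable 𝒯 k ℱ'

IsGreedyOutput : ∀ {n m} → (Fin m → Subset n) → ℕ → Subset m → Set
IsGreedyOutput 𝒯 k ℱ =
  Reachable 𝒯 k ℱ × (2 * k ∸ 2 ≤ ∣ ℱ ∣ ⊎ ¬ (∃ λ ℱ' → Move 𝒯 ℱ ℱ'))

-- Count classes by their least elements.  Adding a test S keeps every least
-- element least, and if S splits a class C of ℱ, the least element of C on the
-- other side of S from min C becomes least in its new class.  A test splitting
-- two distinct classes therefore raises the number of classes by at least 2, so
-- move (b) would still be available, and the algorithm could not have stopped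
-- with |ℱ| < 2k − 2.
module Submission where

open import Defs
open import Data.Nat using (ℕ; _*_; _∸_; _<_; NonZero)
open import Data.Fin using (Fin)
open import Data.Fin.Subset using (Subset; _∉_; ∣_∣)
open import Data.Product using (_×_)
open import Relation.Nullary using (¬_)
open import Relation.Binary.PropositionalEquality using (_≢_)

open import Data.Bool using (Bool; true; false; not; _∧_; _xor_; T; _≟_)
open import Data.Bool.ListAction using (any)
open import Data.Fin as Fin using (toℕ; fromℕ<)
open import Data.Fin.Properties using (toℕ-injective; toℕ-inject; toℕ-fromℕ<; ¬∀⟶∃¬-smallest; <-cmp)
open import Data.Fin.Subset using (_∈_; ⁅_⁆; _∪_; _⊆_)
open import Data.Fin.Subset.Properties using (x∈p∪q⁺; x∈⁅x⁆; p⊆p∪q; ⊆-antisym)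
open import Data.List using (List; []; _∷_; length; filter; allFin)
open import Data.List.Membership.Propositional using (lose) renaming (_∈_ to _∈ₗ_)
open import Data.List.Membership.Propositional.Properties using (∈-filter⁺; ∈-allFin)
open import Data.List.Relation.Unary.Any using (here; there; satisfied)
open import Data.List.Relation.Unary.Any.Properties using (any⁺; any⁻)
open import Data.Nat using (_+_; _≤_; _<ᵇ_; z≤n; s≤s)
open import Data.Nat.Properties using (≤-trans; ≤-reflexive; +-suc; +-monoʳ-≤; m≤n⇒m≤1+n; <⇒≱; <ᵇ⇒<; <⇒<ᵇ; module ≤-Reasoning)
open import Data.Product using (∃; _,_; proj₁; proj₂)
open import Data.Sum using ([_,_]; inj₁; inj₂)
open import Data.Unit using (tt)
open import Data.Vec using (lookup)
open import Data.Vec.Properties using ([]=⇒lookup; lookup⇒[]=)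
open import Function using (_∘_; _⇔_; mk⇔; Equivalence)
open import Relation.Binary using (tri<; tri≈; tri>)
open import Relation.Binary.PropositionalEquality using (_≡_; refl; sym; trans; subst; cong)
open import Relation.Nullary using (Dec; yes; no; contradiction)
open import Relation.Nullary.Decidable using (_×-dec_; ¬?; T?; decidable-stable; map)
open import Relation.Unary using (Pred; Decidable)

open Equivalence using (to; from)

module _ {a p q r} {A : Set a} {P : Pred A p} {Q : Pred A q} {R : Pred A r}
         (P? : Decidable P) (Q? : Decidable Q) (R? : Decidable R) where

  length-filter-disjoint-≤ : (∀ {x} → P x → Q x) → (∀ {x} → R x → Q x) →
    (∀ {x} → R x → ¬ P x) →
    ∀ xs → length (filter P? xs) + length (filter R? xs) ≤ length (filter Q? xs)
  length-filter-disjoint-≤ P⇒Q R⇒Q R⇒¬P [] = z≤n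
  length-filter-disjoint-≤ P⇒Q R⇒Q R⇒¬P (x ∷ xs) with P? x | Q? x | R? x
  ... | yes px | _      | yes rx = contradiction px (R⇒¬P rx)
  ... | yes px | no ¬qx | no _   = contradiction (P⇒Q px) ¬qx
  ... | no _   | no ¬qx | yes rx = contradiction (R⇒Q rx) ¬qx
  ... | yes _  | yes _  | no _   = s≤s (length-filter-disjoint-≤ P⇒Q R⇒Q R⇒¬P xs)
  ... | no _   | yes _  | yes _  =
    ≤-trans (≤-reflexive (+-suc (length (filter P? xs)) (length (filter R? xs))))
            (s≤s (length-filter-disjoint-≤ P⇒Q R⇒Q R⇒¬P xs))
  ... | no _   | yes _  | no _   = m≤n⇒m≤1+n (length-filter-disjoint-≤ P⇒Q R⇒Q R⇒¬P xs)
  ... | no _   | no _   | no _   = length-filter-disjoint-≤ P⇒Q R⇒Q R⇒¬P xs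

∈∧∈∧≢⇒2≤length : ∀ {a} {A : Set a} {x y : A} {xs : List A} →
  x ∈ₗ xs → y ∈ₗ xs → x ≢ y → 2 ≤ length xs
∈∧∈∧≢⇒2≤length (here refl) (here refl) x≢y = contradiction refl x≢y
∈∧∈∧≢⇒2≤length {xs = _ ∷ []} (here _) (there ())
∈∧∈∧≢⇒2≤length {xs = _ ∷ []} (there ()) _
∈∧∈∧≢⇒2≤length {xs = _ ∷ _ ∷ _} (here _) (there _) _ = s≤s (s≤s z≤n)
∈∧∈∧≢⇒2≤length {xs = _ ∷ _ ∷ _} (there _) (here _) _ = s≤s (s≤s z≤n)
∈∧∈∧≢⇒2≤length (there x∈) (there y∈) x≢y = m≤n⇒m≤1+n (∈∧∈∧≢⇒2≤length x∈ y∈ x≢y)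

∃⇒∃-least : ∀ {n p} {P : Pred (Fin n) p} → Decidable P → ∃ P →
  ∃ λ i → P i × (∀ {j} → j Fin.< i → ¬ P j)
∃⇒∃-least {n} {P = P} P? (i , Pi)
  with k , ¬¬Pk , below ← ¬∀⟶∃¬-smallest n (¬_ ∘ P) (¬? ∘ P?) (λ ∀¬P → ∀¬P i Pi)
  = k , decidable-stable (P? k) ¬¬Pk , ¬P-below
  where
  ¬P-below : ∀ {j} → j Fin.< k → ¬ P j
  ¬P-below j<k = subst (¬_ ∘ P) (toℕ-injective (trans (toℕ-inject _) (toℕ-fromℕ< j<k)))
                       (below (fromℕ< j<k))

T-not⇔¬T : ∀ {b} → T (not b) ⇔ (¬ T b)
T-not⇔¬T {false} = mk⇔ (λ _ ()) (λ _ → tt)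
T-not⇔¬T {true}  = mk⇔ (λ ()) (λ ¬⊤ → ¬⊤ tt)

¬T-∧⇔ : ∀ {a b} → (¬ T (a ∧ b)) ⇔ (T a → ¬ T b)
¬T-∧⇔ {false} = mk⇔ (λ _ ()) (λ _ ())
¬T-∧⇔ {true}  = mk⇔ (λ ¬b _ → ¬b) (λ f → f tt)

¬T-xor⇔≡ : ∀ {a b} → (¬ T (a xor b)) ⇔ (a ≡ b)
¬T-xor⇔≡ {false} {false} = mk⇔ (λ _ → refl) (λ _ ())
¬T-xor⇔≡ {false} {true}  = mk⇔ (λ ¬⊤ → contradiction tt ¬⊤) (λ ())
¬T-xor⇔≡ {true}  {false} = mk⇔ (λ ¬⊤ → contradiction tt ¬⊤) (λ ())
¬T-xor⇔≡ {true}  {true}  = mk⇔ (λ _ → refl) (λ _ ())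

T-not-any-allFin⇔ : ∀ {n} (f : Fin n → Bool) → T (not (any f (allFin n))) ⇔ (∀ i → ¬ T (f i))
T-not-any-allFin⇔ {n} f = mk⇔
  (λ none i fi → to T-not⇔¬T none (any⁺ f (lose (∈-allFin i) fi)))
  (λ ∀¬f → from T-not⇔¬T (λ some → let i , fi = satisfied (any⁻ f (allFin n) some) in ∀¬f i fi))

∈⇔T-lookup : ∀ {n} {x : Fin n} {p : Subset n} → x ∈ p ⇔ T (lookup p x)
∈⇔T-lookup {x = x} {p} = mk⇔ (λ x∈p → subst T (sym ([]=⇒lookup x∈p)) tt) from′
  where
  from′ : T (lookup p x) → x ∈ p
  from′ t with lookup p x in eq
  ... | true = lookup⇒[]= x p eq

¬Separates⇔lookup≡ : ∀ {n} {S : Subset n} {i j : Fin n} →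
  (¬ Separates S i j) ⇔ (lookup S i ≡ lookup S j)
¬Separates⇔lookup≡ {S = S} {i} {j} = mk⇔ to′ from′
  where
  to′ : ¬ Separates S i j → lookup S i ≡ lookup S j
  to′ ¬sep with lookup S i in eᵢ | lookup S j in eⱼ
  ... | false | false = refl
  ... | true  | true  = refl
  ... | true  | false = contradiction (inj₁ (lookup⇒[]= i S eᵢ , λ j∈ → subst T eⱼ (to ∈⇔T-lookup j∈))) ¬sep
  ... | false | true  = contradiction (inj₂ ((λ i∈ → subst T eᵢ (to ∈⇔T-lookup i∈)) , lookup⇒[]= j S eⱼ)) ¬sep
  from′ : lookup S i ≡ lookup S j → ¬ Separates S i j
  from′ eq (inj₁ (i∈ , j∉)) = j∉ (from ∈⇔T-lookup (subst T eq (to ∈⇔T-lookup i∈)))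
  from′ eq (inj₂ (i∉ , j∈)) = i∉ (from ∈⇔T-lookup (subst T (sym eq) (to ∈⇔T-lookup j∈)))

module _ {n m} (𝒯 : Fin m → Subset n) where

  Agree : Subset m → Fin n → Fin n → Set
  Agree F i j = ∀ t → t ∈ F → lookup (𝒯 t) i ≡ lookup (𝒯 t) j

  Agree-refl : ∀ {F i} → Agree F i i
  Agree-refl _ _ = refl

  Agree-sym : ∀ {F i j} → Agree F i j → Agree F j i
  Agree-sym i~j t t∈F = sym (i~j t t∈F)

  Agree-trans : ∀ {F i j k} → Agree F i j → Agree F j k → Agree F i k
  Agree-trans i~j j~k t t∈F = trans (i~j t t∈F) (j~k t t∈F)

  Agree-antimono : ∀ {F G i j} → F ⊆ G → Agree G i j → Agree F i j
  Agree-antimono F⊆G i~j t t∈F = i~j t (F⊆G t∈F)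

  Unseparated⇔Agree : ∀ {F i j} → Unseparated 𝒯 F i j ⇔ Agree F i j
  Unseparated⇔Agree = mk⇔ (λ u t t∈F → to ¬Separates⇔lookup≡ (u t t∈F))
                          (λ i~j t t∈F → from ¬Separates⇔lookup≡ (i~j t t∈F))

  T-unsepᵇ⇔Agree : ∀ {F i j} → T (unsepᵇ 𝒯 F i j) ⇔ Agree F i j
  T-unsepᵇ⇔Agree {F} {i} {j} = mk⇔
    (λ u t t∈F → to ¬T-xor⇔≡ (to ¬T-∧⇔ (to (T-not-any-allFin⇔ _) u t) (to ∈⇔T-lookup t∈F)))
    (λ i~j → from (T-not-any-allFin⇔ _) λ t →
      from ¬T-∧⇔ λ t∈F → from ¬T-xor⇔≡ (i~j t (from ∈⇔T-lookup t∈F)))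

  Agree? : ∀ F i → Decidable (Agree F i)
  Agree? F i j = map T-unsepᵇ⇔Agree (T? (unsepᵇ 𝒯 F i j))

  -- The same function as the one local to numClasses, so that numClasses 𝒯 F
  -- unfolds to a filter by isRepᵇ F.
  isRepᵇ : Subset m → Fin n → Bool
  isRepᵇ F i = not (any (λ j → (toℕ j <ᵇ toℕ i) ∧ unsepᵇ 𝒯 F j i) (allFin n))

  IsRep : Subset m → Fin n → Set
  IsRep F i = ∀ {j} → j Fin.< i → ¬ Agree F j i

  T-isRepᵇ⇔IsRep : ∀ {F i} → T (isRepᵇ F i) ⇔ IsRep F i
  T-isRepᵇ⇔IsRep {F} {i} = mk⇔ to′ from′
    where
    to′ : T (isRepᵇ F i) → IsRep F i
    to′ rep {j} j<i j~i =
      to ¬T-∧⇔ (to (T-not-any-allFin⇔ _) rep j) (<⇒<ᵇ j<i) (from T-unsepᵇ⇔Agree j~i)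
    from′ : IsRep F i → T (isRepᵇ F i)
    from′ rep = from (T-not-any-allFin⇔ _) λ j →
      from ¬T-∧⇔ λ j<ᵇi → rep (<ᵇ⇒< (toℕ j) (toℕ i) j<ᵇi) ∘ to T-unsepᵇ⇔Agree

  IsRep-mono : ∀ {F G i} → F ⊆ G → IsRep F i → IsRep G i
  IsRep-mono F⊆G rep j<i = rep j<i ∘ Agree-antimono F⊆G

  NewRep : Subset m → Subset m → Fin n → Set
  NewRep F G i = IsRep G i × ¬ IsRep F i

  two-NewReps⇒numClasses-+2 : ∀ {F G r₁ r₂} → F ⊆ G → r₁ ≢ r₂ →
    NewRep F G r₁ → NewRep F G r₂ → numClasses 𝒯 F + 2 ≤ numClasses 𝒯 G
  two-NewReps⇒numClasses-+2 {F} {G} {r₁} {r₂} F⊆G r₁≢r₂ new₁ new₂ = begin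
    numClasses 𝒯 F + 2
      ≤⟨ +-monoʳ-≤ (numClasses 𝒯 F) (∈∧∈∧≢⇒2≤length (listed new₁) (listed new₂) r₁≢r₂) ⟩
    numClasses 𝒯 F + length (filter NewRepᵇ? (allFin n))
      ≤⟨ length-filter-disjoint-≤ (T? ∘ isRepᵇ F) (T? ∘ isRepᵇ G) NewRepᵇ?
           (from T-isRepᵇ⇔IsRep ∘ IsRep-mono F⊆G ∘ to T-isRepᵇ⇔IsRep) proj₁ proj₂ (allFin n) ⟩
    numClasses 𝒯 G ∎
    where
    open ≤-Reasoning
    NewRepᵇ? : Decidable (λ i → T (isRepᵇ G i) × ¬ T (isRepᵇ F i))
    NewRepᵇ? i = T? (isRepᵇ G i) ×-dec ¬? (T? (isRepᵇ F i))
    listed : ∀ {r} → NewRep F G r → r ∈ₗ filter NewRepᵇ? (allFin n)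
    listed (repG , ¬repF) =
      ∈-filter⁺ NewRepᵇ? (∈-allFin _) (from T-isRepᵇ⇔IsRep repG , ¬repF ∘ to T-isRepᵇ⇔IsRep)

  least-across⇒NewRep : ∀ {F s a m₀ r} →
    Agree F a m₀ → (∀ {j} → j Fin.< m₀ → ¬ Agree F a j) →
    Agree F a r → lookup (𝒯 s) r ≢ lookup (𝒯 s) m₀ →
    (∀ {j} → j Fin.< r → ¬ (Agree F a j × lookup (𝒯 s) j ≢ lookup (𝒯 s) m₀)) →
    NewRep F (F ∪ ⁅ s ⁆) r
  least-across⇒NewRep {F} {s} {a} {m₀} {r} a~m₀ m₀-least a~r Sr≢Sm₀ r-least = rep′ , ¬rep
    where
    m₀<r : m₀ Fin.< r
    m₀<r with <-cmp m₀ r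
    ... | tri< m₀<r _ _ = m₀<r
    ... | tri≈ _ m₀≡r _ = contradiction (cong (lookup (𝒯 s)) (sym m₀≡r)) Sr≢Sm₀
    ... | tri> _ _ r<m₀ = contradiction a~r (m₀-least r<m₀)
    ¬rep : ¬ IsRep F r
    ¬rep rep = rep m₀<r (Agree-trans (Agree-sym a~m₀) a~r)
    rep′ : IsRep (F ∪ ⁅ s ⁆) r
    rep′ j<r j~r = r-least j<r
      ( Agree-trans a~r (Agree-sym (Agree-antimono (p⊆p∪q _) j~r))
      , λ Sj≡Sm₀ → Sr≢Sm₀ (trans (sym (j~r s (x∈p∪q⁺ (inj₂ (x∈⁅x⁆ s))))) Sj≡Sm₀) )

  splitting-test⇒NewRep : ∀ {F s a b} → Agree F a b → lookup (𝒯 s) a ≢ lookup (𝒯 s) b →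
    ∃ λ r → Agree F a r × NewRep F (F ∪ ⁅ s ⁆) r
  splitting-test⇒NewRep {F} {s} {a} {b} a~b Sa≢Sb =
    let m₀ , a~m₀ , m₀-least = ∃⇒∃-least (Agree? F a) (a , Agree-refl)
        r , (a~r , Sr≢Sm₀) , r-least = ∃⇒∃-least (Across? m₀) (across (S a ≟ S m₀))
    in r , a~r , least-across⇒NewRep a~m₀ m₀-least a~r Sr≢Sm₀ r-least
    where
    S = lookup (𝒯 s)
    Across? : ∀ m₀ → Decidable (λ j → Agree F a j × S j ≢ S m₀)
    Across? m₀ j = Agree? F a j ×-dec ¬? (S j ≟ S m₀)
    across : ∀ {m₀} → Dec (S a ≡ S m₀) → ∃ λ j → Agree F a j × S j ≢ S m₀
    across (yes Sa≡Sm₀) = b , a~b , λ Sb≡Sm₀ → Sa≢Sb (trans Sa≡Sm₀ (sym Sb≡Sm₀))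
    across (no  Sa≢Sm₀) = a , Agree-refl , Sa≢Sm₀

  module _ {F : Subset m} where

    class-members-Agree : ∀ {C x y} → IsClass 𝒯 F C → x ∈ C → y ∈ C → Agree F x y
    class-members-Agree (_ , C≈) x∈C y∈C =
      Agree-trans (Agree-sym (member x∈C)) (member y∈C)
      where member = λ {z} z∈C → to Unseparated⇔Agree (to (C≈ z) z∈C)

    class-closed : ∀ {C x y} → IsClass 𝒯 F C → x ∈ C → Agree F x y → y ∈ C
    class-closed (_ , C≈) x∈C x~y =
      from (C≈ _) (from Unseparated⇔Agree (Agree-trans (to Unseparated⇔Agree (to (C≈ _) x∈C)) x~y))

    classes-meet⇒≡ : ∀ {C D x} → IsClass 𝒯 F C → IsClass 𝒯 F D → x ∈ C → x ∈ D → C ≡ D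
    classes-meet⇒≡ C-class D-class x∈C x∈D = ⊆-antisym
      (λ y∈C → class-closed D-class x∈D (class-members-Agree C-class x∈C y∈C))
      (λ y∈D → class-closed C-class x∈C (class-members-Agree D-class x∈D y∈D))

    CTest⇒NewRep : ∀ {C s} → IsClass 𝒯 F C → IsCTest C (𝒯 s) →
      ∃ λ r → r ∈ C × NewRep F (F ∪ ⁅ s ⁆) r
    CTest⇒NewRep {s = s} C-class ((x , x∈C , x∉S) , (y , y∈C , y∈S)) =
      let r , x~r , new = splitting-test⇒NewRep (class-members-Agree C-class x∈C y∈C) Sx≢Sy
      in r , class-closed C-class x∈C x~r , new
      where
      Sx≢Sy : lookup (𝒯 s) x ≢ lookup (𝒯 s) y
      Sx≢Sy Sx≡Sy = from ¬Separates⇔lookup≡ Sx≡Sy (inj₂ (x∉S , y∈S))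

lemma4 : ∀ {n m} (𝒯 : Fin m → Subset n) (k : ℕ) → NonZero k →
    Distinct 𝒯 → IsTestCover 𝒯 →
    (ℱ : Subset m) → IsGreedyOutput 𝒯 k ℱ → ∣ ℱ ∣ < 2 * k ∸ 2 →
    (C D : Subset n) → IsClass 𝒯 ℱ C → IsClass 𝒯 ℱ D → C ≢ D →
    (s : Fin m) → s ∉ ℱ → ¬ (IsCTest C (𝒯 s) × IsCTest D (𝒯 s))
lemma4 𝒯 _ _ _ _ ℱ (_ , stopped) small C D C-class D-class C≢D s s∉ℱ (C-test , D-test) =
  [ <⇒≱ small , (λ noMove → noMove (ℱ ∪ ⁅ s ⁆ , moveB s s∉ℱ more)) ] stopped
  where
  more : numClasses 𝒯 ℱ + 2 ≤ numClasses 𝒯 (ℱ ∪ ⁅ s ⁆)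
  more =
    let r₁ , r₁∈C , new₁ = CTest⇒NewRep 𝒯 C-class C-test
        r₂ , r₂∈D , new₂ = CTest⇒NewRep 𝒯 D-class D-test
        r₁≢r₂ = λ r₁≡r₂ → C≢D (classes-meet⇒≡ 𝒯 C-class D-class r₁∈C (subst (_∈ D) (sym r₁≡r₂) r₂∈D))
    in two-NewReps⇒numClasses-+2 𝒯 (p⊆p∪q _) r₁≢r₂ new₁ new₂
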